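{- Let $n\geq 7$. Let $u_1,v_1,w_1$ be distinct vertices in $C_{n,1}$, let $u_2,v_2$ be distinct vertices in $C_{n,n-1}$, and let $z_1$ be either of the two neighbors of $w_1$ in $C_{n,2}$. Then there is a pair of vertex-disjoint paths covering all vertices of $\mathcal{Q}_n-\{\mathbf{0},\mathbf{1}\}$, one from $u_1$ to $v_1$ passing through the edge $w_1z_1$, and the other from $u_2$ to $v_2$.
   Context: $\mathcal{Q}_n$ is the $n$-dimensional hypercube graph on binary vectors of length $n$, adjacent iff they differ in exactly one coordinate; $\mathbf{0},\mathbf{1}$ are the all-zero and all-one vectors. A vector is lean if its support (set of coordinates equal to $1$) is a cyclic interval of $\{1,\dots,n\}$ (a set $\{k+1,\dots,k+\ell\}$ mod $n$); $C_{n,j}$ denotes the set of lean vectors with exactly $j$ ones. -}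

module Defs where

open import Data.Bool using (Bool; true; false; _xor_)
open import Data.Nat using (ℕ; zero; suc; _+_; _∸_; _≤_; _<_)
open import Data.Fin using (Fin; toℕ)
open import Data.Vec using (Vec; []; _∷_; lookup; replicate)
open import Data.List using (List; []; _∷_; _++_; head; last)
open import Data.List.Relation.Unary.Linked using (Linked)
open import Data.List.Relation.Unary.Unique.Propositional using (Unique)
open import Data.List.Membership.Propositional using (_∈_; _∉_)
open import Data.Maybe using (just)
open import Data.Product using (Σ; ∃; ∃-syntax; _×_; _,_)
open import Data.Sum using (_⊎_)
open import Relation.Binary.PropositionalEquality using (_≡_; _≢_)
open import Relation.Nullary using (¬_)
open import Function.Bundles using (_⇔_)

Vertex : ℕ → Set
Vertex n = Vec Bool n

𝟎 : (n : ℕ) → Vertex n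
𝟎 n = replicate n false

𝟏 : (n : ℕ) → Vertex n
𝟏 n = replicate n true

hamming : ∀ {n} → Vertex n → Vertex n → ℕ
hamming []       []       = 0
hamming (a ∷ xs) (b ∷ ys) = (if a xor b then 1 else 0) + hamming xs ys
  where open import Data.Bool using (if_then_else_)

Adjacent : ∀ {n} → Vertex n → Vertex n → Set
Adjacent x y = hamming x y ≡ 1

weight : ∀ {n} → Vertex n → ℕ
weight []          = 0
weight (true ∷ xs)  = suc (weight xs)
weight (false ∷ xs) = weight xs

-- Coordinates are 0-indexed: i ∈ {0,…,n-1}.  The cyclic interval starting at
-- k (0 ≤ k < n) of length ℓ (0 ≤ ℓ ≤ n) is {k, k+1, …, k+ℓ-1} taken mod n,
-- i.e. i belongs to it iff k ≤ i < k+ℓ or i+n < k+ℓ.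
InCyclicInterval : (n k ℓ : ℕ) → ℕ → Set
InCyclicInterval n k ℓ i = (k ≤ i × i < k + ℓ) ⊎ (i + n < k + ℓ)

Lean : ∀ {n} → Vertex n → Set
Lean {n} v = ∃[ k ] ∃[ ℓ ] (k < n × ℓ ≤ n ×
  ((i : Fin n) → (lookup v i ≡ true) ⇔ InCyclicInterval n k ℓ (toℕ i)))

InC : (n j : ℕ) → Vertex n → Set
InC n j v = Lean v × weight v ≡ j

IsPath : ∀ {n} → Vertex n → Vertex n → List (Vertex n) → Set
IsPath u v P = head P ≡ just u × last P ≡ just v × Linked Adjacent P × Unique P

UsesEdge : ∀ {n} → Vertex n → Vertex n → List (Vertex n) → Set
UsesEdge a b P = ∃[ xs ] ∃[ ys ] (P ≡ xs ++ a ∷ b ∷ ys ⊎ P ≡ xs ++ b ∷ a ∷ ys)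

module Submission where

-- The five vertices u₁, v₁, z₁,
-- ū₂, v̄₂ (bars denoting complements) carry 1 + 1 + 2 + 1 + 1 = 6 < n ones in
-- total, so some coordinate k is 0 in all of them; w₁ ⊆ z₁ is 0 there too.
-- Splitting Q_n along k, the path from u₁ to v₁ is built in the face x_k = 0
-- (avoiding 𝟎) and the path from u₂ to v₂ in the face x_k = 1 (avoiding 𝟏).
--
-- In the face x_k = 0 we need a Hamiltonian path of Q_m − 𝟎 between two weight-one
-- vertices through a prescribed edge wz.  For m = 4 this is checked by computer;
-- for m > 4 a further coordinate is free in s, t, z, and the path of the smaller
-- face is extended by replacing its first edge s q by a detour through a
-- Hamiltonian path from s to q of the opposite face, which exists by Havel's
-- theorem: Q_m has a Hamiltonian path between any two vertices of opposite parity
-- (proved by the same detour construction).  The path avoiding 𝟏 is the complement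
-- of one avoiding 𝟎, obtained from the previous case through a dummy edge.

open import Defs
open import Data.Bool using (Bool; true; false; not; _xor_; if_then_else_)
import Data.Bool.Properties as Boolₚ
open import Data.Nat using (ℕ; zero; suc; _+_; _∸_; _*_; _%_; _/_; _≤_; _<_; _≤′_; ≤′-refl; ≤′-step; s≤s; s≤s⁻¹)
import Data.Nat as ℕ
open import Data.Nat.Properties
  using (suc-injective; ≤-refl; ≤-trans; n≤1+n; <-≤-trans; +-mono-≤; +-mono-≤-<; +-mono-<-≤; +-suc; +-cancelʳ-≡;
         m≢1+n+m; m≤m+n; ≤⇒≤′; ≤′⇒≤)
open import Data.Nat.ListAction using (sum)
open import Data.Fin using (Fin; zero; suc)
open import Data.Fin.Subset.Properties using (anySubset?)
open import Data.Vec using ([]; _∷_; lookup; replicate; insertAt; removeAt; tail)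
import Data.Vec as Vec
open import Data.Vec.Properties
  using (≡-dec; insertAt-lookup; removeAt-insertAt; insertAt-removeAt; lookup-map; map-insertAt; map-replicate)
open import Data.List using (List; []; _∷_; _++_; map; last)
open import Data.List.Properties using (map-++; ++-assoc; ++-identityʳ)
open import Data.List.Relation.Unary.All using (All; []; _∷_; all?)
import Data.List.Relation.Unary.All as All
import Data.List.Relation.Unary.All.Properties as All
open import Data.List.Relation.Unary.AllPairs using ([]; _∷_)
open import Data.List.Relation.Unary.Any using (here; there)
open import Data.List.Relation.Unary.Linked using (Linked; [-]; _∷_)
open import Data.List.Relation.Unary.Unique.Propositional using (Unique)
import Data.List.Relation.Unary.Unique.Propositional.Properties as Unique
open import Data.List.Relation.Binary.Permutation.Propositional using (_↭_; ↭-prep; ↭-sym; ↭⇒↭ₛ)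
open import Data.List.Relation.Binary.Permutation.Propositional.Properties using (∈-resp-↭; ++-comm)
import Data.List.Relation.Binary.Permutation.Setoid.Properties as Permutationₛ
open import Data.List.Membership.Propositional using (_∈_; _∉_)
open import Data.List.Membership.Propositional.Properties using (∈-map⁺; ∈-map⁻; ∈-++⁺ˡ; ∈-++⁺ʳ; ∈-++⁻)
open import Data.Maybe using (just)
open import Data.Product using (∃-syntax; _×_; _,_; proj₁; proj₂)
import Data.Product as Product
open import Data.Sum using (_⊎_; inj₁; inj₂)
open import Data.Unit using (tt)
open import Function using (_∘_)
open import Relation.Nullary using (¬_; Dec; yes; no; ¬?; contradiction)
open import Relation.Nullary.Decidable using (map′; _×-dec_; _→-dec_; toWitness; decidable-stable)
open import Relation.Binary.Definitions using (DecidableEquality)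
open import Relation.Binary.PropositionalEquality using (_≡_; _≢_; refl; sym; trans; cong; cong₂; subst; setoid)

private
  variable
    m : ℕ
    b c : Bool
    s t u v w x y z p q : Vertex m
    P Q R H X Y : List (Vertex m)

-- Hypercube

_≟ᵥ_ : DecidableEquality (Vertex m)
_≟ᵥ_ = ≡-dec Boolₚ._≟_

adjacent? : (x y : Vertex m) → Dec (Adjacent x y)
adjacent? x y = hamming x y ℕ.≟ 1

hamming-refl : (x : Vertex m) → hamming x x ≡ 0
hamming-refl []          = refl
hamming-refl (true ∷ x)  = hamming-refl x
hamming-refl (false ∷ x) = hamming-refl x

hamming-sym : (x y : Vertex m) → hamming x y ≡ hamming y x
hamming-sym []          []          = refl
hamming-sym (true ∷ x)  (true ∷ y)  = hamming-sym x y
hamming-sym (true ∷ x)  (false ∷ y) = cong suc (hamming-sym x y)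
hamming-sym (false ∷ x) (true ∷ y)  = cong suc (hamming-sym x y)
hamming-sym (false ∷ x) (false ∷ y) = hamming-sym x y

hamming≡0⇒≡ : (x y : Vertex m) → hamming x y ≡ 0 → x ≡ y
hamming≡0⇒≡ []          []          _ = refl
hamming≡0⇒≡ (true ∷ x)  (true ∷ y)  h = cong (true ∷_) (hamming≡0⇒≡ x y h)
hamming≡0⇒≡ (false ∷ x) (false ∷ y) h = cong (false ∷_) (hamming≡0⇒≡ x y h)

adjacent-sym : Adjacent x y → Adjacent y x
adjacent-sym {x = x} {y} xy = trans (hamming-sym y x) xy

parity : Vertex m → Bool
parity []      = false
parity (a ∷ x) = a xor parity x

adjacent-parity : Adjacent x y → parity x ≡ not (parity y)
adjacent-parity {x = []}        {[]}        ()
adjacent-parity {x = true ∷ x}  {true ∷ y}  xy = cong not (adjacent-parity {x = x} {y} xy)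
adjacent-parity {x = false ∷ x} {false ∷ y} xy = adjacent-parity {x = x} {y} xy
adjacent-parity {x = true ∷ x}  {false ∷ y} xy rewrite hamming≡0⇒≡ x y (suc-injective xy) = refl
adjacent-parity {x = false ∷ x} {true ∷ y}  xy rewrite hamming≡0⇒≡ x y (suc-injective xy) =
  sym (Boolₚ.not-involutive (parity y))

insertAt-replicate : ∀ {A : Set} n (k : Fin (suc n)) (a : A) → insertAt (replicate n a) k a ≡ replicate (suc n) a
insertAt-replicate n       zero    a = refl
insertAt-replicate (suc n) (suc k) a = cong (a ∷_) (insertAt-replicate n k a)

complement : Vertex m → Vertex m
complement = Vec.map not

hamming-complement : (x y : Vertex m) → hamming (complement x) (complement y) ≡ hamming x y
hamming-complement []          []          = refl
hamming-complement (true ∷ x)  (true ∷ y)  = hamming-complement x y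
hamming-complement (true ∷ x)  (false ∷ y) = cong suc (hamming-complement x y)
hamming-complement (false ∷ x) (true ∷ y)  = cong suc (hamming-complement x y)
hamming-complement (false ∷ x) (false ∷ y) = hamming-complement x y

complement-involutive : (x : Vertex m) → complement (complement x) ≡ x
complement-involutive []      = refl
complement-involutive (a ∷ x) = cong₂ _∷_ (Boolₚ.not-involutive a) (complement-involutive x)

complement-injective : complement x ≡ complement y → x ≡ y
complement-injective {x = x} {y} e =
  trans (sym (complement-involutive x)) (trans (cong complement e) (complement-involutive y))

lookup-complement : ∀ (x : Vertex m) k → lookup (complement x) k ≡ false → lookup x k ≡ true
lookup-complement x k e = Boolₚ.not-injective (trans (sym (lookup-map k not x)) e)

weight-complement : (x : Vertex m) → weight (complement x) + weight x ≡ m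
weight-complement []          = refl
weight-complement (false ∷ x) = cong suc (weight-complement x)
weight-complement (true ∷ x)  = trans (+-suc _ _) (cong suc (weight-complement x))

weight-𝟎 : ∀ m → weight (𝟎 m) ≡ 0
weight-𝟎 zero    = refl
weight-𝟎 (suc m) = weight-𝟎 m

weight-complement≡1 : (x : Vertex (suc m)) → weight x ≡ m → weight (complement x) ≡ 1
weight-complement≡1 {m} x ∣x∣ =
  +-cancelʳ-≡ m _ 1 (trans (cong (weight (complement x) +_) (sym ∣x∣)) (weight-complement x))

weight-tail-≤ : (x : Vertex (suc m)) → weight (tail x) ≤ weight x
weight-tail-≤ (false ∷ x) = ≤-refl
weight-tail-≤ (true ∷ x)  = n≤1+n _

weight-tail-< : (x : Vertex (suc m)) → lookup x zero ≢ false → weight (tail x) < weight x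
weight-tail-< (false ∷ x) x₀≢false = contradiction refl x₀≢false
weight-tail-< (true ∷ x)  _        = ≤-refl

sum-weight-tail-≤ : (xs : List (Vertex (suc m))) → sum (map weight (map tail xs)) ≤ sum (map weight xs)
sum-weight-tail-≤ []       = ≤-refl
sum-weight-tail-≤ (x ∷ xs) = +-mono-≤ (weight-tail-≤ x) (sum-weight-tail-≤ xs)

sum-weight-tail-< : (xs : List (Vertex (suc m))) → ¬ All (λ x → lookup x zero ≡ false) xs →
  sum (map weight (map tail xs)) < sum (map weight xs)
sum-weight-tail-< []       ¬all = contradiction [] ¬all
sum-weight-tail-< (x ∷ xs) ¬all with lookup x zero Boolₚ.≟ false
... | yes x₀ = +-mono-≤-< (weight-tail-≤ x) (sum-weight-tail-< xs (¬all ∘ (x₀ ∷_)))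
... | no ¬x₀ = +-mono-<-≤ (weight-tail-< x ¬x₀) (sum-weight-tail-≤ xs)

free-coordinate : (xs : List (Vertex m)) → sum (map weight xs) < m →
  ∃[ k ] All (λ x → lookup x k ≡ false) xs
free-coordinate {suc m} xs bound with all? (λ x → lookup x zero Boolₚ.≟ false) xs
... | yes all₀ = zero , all₀
... | no ¬all₀ with free-coordinate (map tail xs) (<-≤-trans (sum-weight-tail-< xs ¬all₀) (s≤s⁻¹ bound))
...   | k , allₖ = suc k , lookup-suc xs allₖ
  where
  lookup-suc : ∀ {k} (xs : List (Vertex (suc m))) → All (λ x → lookup x k ≡ false) (map tail xs) →
    All (λ x → lookup x (suc k) ≡ false) xs
  lookup-suc []             []       = []
  lookup-suc ((_ ∷ _) ∷ xs) (e ∷ es) = e ∷ lookup-suc xs es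

lookup-false-below : ∀ (w z : Vertex m) k → Adjacent w z → weight z ≡ suc (weight w) →
  lookup z k ≡ false → lookup w k ≡ false
lookup-false-below (true ∷ w)  (false ∷ z) k       wz ∣z∣ _  with hamming≡0⇒≡ w z (suc-injective wz)
... | refl = contradiction ∣z∣ (m≢1+n+m (weight w) {1})
lookup-false-below (false ∷ w) (_ ∷ z)     zero    _  _   _  = refl
lookup-false-below (true ∷ w)  (true ∷ z)  zero    _  _   ()
lookup-false-below (false ∷ w) (false ∷ z) (suc k) wz ∣z∣ zₖ = lookup-false-below w z k wz ∣z∣ zₖ
lookup-false-below (true ∷ w)  (true ∷ z)  (suc k) wz ∣z∣ zₖ = lookup-false-below w z k wz (suc-injective ∣z∣) zₖ
lookup-false-below (false ∷ w) (true ∷ z)  (suc k) wz _   zₖ =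
  subst (λ v → lookup v k ≡ false) (sym (hamming≡0⇒≡ w z (suc-injective wz))) zₖ

-- Faces

face : Fin (suc m) → Bool → Vertex m → Vertex (suc m)
face k b v = insertAt v k b

hamming-face : ∀ k b (x y : Vertex m) → hamming (face k b x) (face k b y) ≡ hamming x y
hamming-face zero    true  x       y       = refl
hamming-face zero    false x       y       = refl
hamming-face (suc k) b     (a ∷ x) (c ∷ y) = cong ((if a xor c then 1 else 0) +_) (hamming-face k b x y)

face-flip-adjacent : ∀ k b (v : Vertex m) → Adjacent (face k b v) (face k (not b) v)
face-flip-adjacent zero    true  v       = cong suc (hamming-refl v)
face-flip-adjacent zero    false v       = cong suc (hamming-refl v)
face-flip-adjacent (suc k) b     (a ∷ v) =
  trans (cong (λ d → (if d then 1 else 0) + _) (Boolₚ.xor-same a)) (face-flip-adjacent k b v)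

face-injective : ∀ k → face k b x ≡ face k c y → x ≡ y × b ≡ c
face-injective {b = b} {x = x} {c = c} {y = y} k e =
  trans (sym (removeAt-insertAt x k b)) (trans (cong (λ v → removeAt v k) e) (removeAt-insertAt y k c)) ,
  trans (sym (insertAt-lookup x k b)) (trans (cong (λ v → lookup v k) e) (insertAt-lookup y k c))

faces-disjoint : ∀ k → face k b x ≢ face k (not b) y
faces-disjoint {b = b} k e = Boolₚ.not-¬ refl (proj₂ (face-injective {b = b} k e))

weight-face : ∀ k b (v : Vertex m) → weight (face k b v) ≡ weight (b ∷ v)
weight-face zero    b     v           = refl
weight-face (suc k) true  (true ∷ v)  = cong suc (weight-face k true v)
weight-face (suc k) true  (false ∷ v) = weight-face k true v
weight-face (suc k) false (true ∷ v)  = cong suc (weight-face k false v)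
weight-face (suc k) false (false ∷ v) = weight-face k false v

face-𝟎 : ∀ k → face k false (𝟎 m) ≡ 𝟎 (suc m)
face-𝟎 k = insertAt-replicate _ k false

face-𝟏 : ∀ k → face k true (𝟏 m) ≡ 𝟏 (suc m)
face-𝟏 k = insertAt-replicate _ k true

complement-face : ∀ k b (v : Vertex m) → complement (face k b v) ≡ face k (not b) (complement v)
complement-face k b v = map-insertAt not b v k

lookup⇒face : ∀ (x : Vertex (suc m)) k → lookup x k ≡ b → ∃[ v ] x ≡ face k b v
lookup⇒face x k refl = removeAt x k , sym (insertAt-removeAt x k)

data FaceView (k : Fin (suc m)) : Vertex (suc m) → Set where
  face-of : ∀ b v → FaceView k (face k b v)

faceView : ∀ k (x : Vertex (suc m)) → FaceView k x
faceView k x = subst (FaceView k) (insertAt-removeAt x k) (face-of (lookup x k) (removeAt x k))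

∈-map-face⁻ : ∀ k → face k c v ∈ map (face k b) P → v ∈ P × c ≡ b
∈-map-face⁻ k v∈ with ∈-map⁻ _ v∈
... | u , u∈P , e with face-injective k e
...   | refl , c≡b = u∈P , c≡b

-- Walks and Hamiltonian paths

data Walk {m} : Vertex m → Vertex m → List (Vertex m) → Set where
  [_]  : ∀ x → Walk x x (x ∷ [])
  step : ∀ {x y z P} → Adjacent x y → Walk y z (y ∷ P) → Walk x z (x ∷ y ∷ P)

walk-∷ : Adjacent x y → Walk y z P → Walk x z (x ∷ P)
walk-∷ xy yz@([ _ ])     = step xy yz
walk-∷ xy yz@(step _ _) = step xy yz

walk-++ : Walk x y P → Adjacent y u → Walk u z Q → Walk x z (P ++ Q)
walk-++ [ _ ]       yu uz = walk-∷ yu uz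
walk-++ (step xy w) yu uz = step xy (walk-++ w yu uz)

walk-map : ∀ {n} (f : Vertex m → Vertex n) → (∀ {x y} → Adjacent x y → Adjacent (f x) (f y)) →
           Walk x y P → Walk (f x) (f y) (map f P)
walk-map f f-adj [ x ]       = [ f x ]
walk-map f f-adj (step xy w) = step (f-adj xy) (walk-map f f-adj w)

walk? : ∀ (x y : Vertex m) P → Dec (Walk x y P)
walk? x y []          = no λ ()
walk? x y (a ∷ [])    =
  map′ (λ { (refl , refl) → [ x ] }) (λ { [ _ ] → refl , refl }) (x ≟ᵥ a ×-dec a ≟ᵥ y)
walk? x y (a ∷ b ∷ P) =
  map′ (λ { (refl , ab , w) → step ab w }) (λ { (step ab w) → refl , ab , w })
       (x ≟ᵥ a ×-dec adjacent? a b ×-dec walk? b y (b ∷ P))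

walk⇒isPath : Walk x y P → Unique P → IsPath x y P
walk⇒isPath [ _ ]          P! = refl , refl , [-] , P!
walk⇒isPath w@(step _ _)   P! = refl , last-walk w , linked w , P!
  where
  last-walk : Walk x y P → last P ≡ just y
  last-walk [ _ ]                  = refl
  last-walk (step _ [ _ ])         = refl
  last-walk (step _ w@(step _ _)) = last-walk w
  linked : Walk x y P → Linked Adjacent P
  linked [ _ ]       = [-]
  linked (step xy w) = xy ∷ linked w

usesEdge-map : ∀ {n} (f : Vertex m → Vertex n) → UsesEdge w z P → UsesEdge (f w) (f z) (map f P)
usesEdge-map f (xs , ys , inj₁ refl) = map f xs , map f ys , inj₁ (map-++ f xs _)
usesEdge-map f (xs , ys , inj₂ refl) = map f xs , map f ys , inj₂ (map-++ f xs _)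

usesEdge-++ʳ : ∀ P → UsesEdge w z Q → UsesEdge w z (P ++ Q)
usesEdge-++ʳ P (xs , ys , inj₁ refl) = P ++ xs , ys , inj₁ (sym (++-assoc P xs _))
usesEdge-++ʳ P (xs , ys , inj₂ refl) = P ++ xs , ys , inj₂ (sym (++-assoc P xs _))

usesEdge-∷⁻ : UsesEdge w z (x ∷ P) → x ≢ w → x ≢ z → UsesEdge w z P
usesEdge-∷⁻ ([]     , ys , inj₁ refl) x≢w x≢z = contradiction refl x≢w
usesEdge-∷⁻ ([]     , ys , inj₂ refl) x≢w x≢z = contradiction refl x≢z
usesEdge-∷⁻ (_ ∷ xs , ys , inj₁ refl) x≢w x≢z = xs , ys , inj₁ refl
usesEdge-∷⁻ (_ ∷ xs , ys , inj₂ refl) x≢w x≢z = xs , ys , inj₂ refl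

record Spans (X P : List (Vertex m)) : Set where
  field
    unique : Unique P
    avoids : All (_∉ P) X
    covers : ∀ v → v ∉ X → v ∈ P

HamiltonianPath : List (Vertex m) → Vertex m → Vertex m → List (Vertex m) → Set
HamiltonianPath X s t P = Walk s t P × Spans X P

hamiltonianPath-≡ : X ≡ Y → s ≡ u → t ≡ v → HamiltonianPath X s t P → HamiltonianPath Y u v P
hamiltonianPath-≡ refl refl refl ham = ham

spans-resp-↭ : P ↭ Q → Spans X P → Spans X Q
spans-resp-↭ P↭Q S = record
  { unique = Permutationₛ.Unique-resp-↭ (setoid _) (↭⇒↭ₛ P↭Q) unique
  ; avoids = All.map (λ x∉P x∈Q → x∉P (∈-resp-↭ (↭-sym P↭Q) x∈Q)) avoids
  ; covers = λ v v∉X → ∈-resp-↭ P↭Q (covers v v∉X)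
  }
  where open Spans S

face-adjacent : ∀ k b → Adjacent x y → Adjacent (face k b x) (face k b y)
face-adjacent {x = x} {y} k b xy = trans (hamming-face k b x y) xy

across : Fin (suc m) → Bool → List (Vertex m) → List (Vertex m) → List (Vertex (suc m))
across k b P Q = map (face k b) P ++ map (face k (not b)) Q

∈-across⁻ : ∀ k → face k c v ∈ across k b P Q → (v ∈ P × c ≡ b) ⊎ (v ∈ Q × c ≡ not b)
∈-across⁻ {P = P} k v∈ with ∈-++⁻ (map _ P) v∈
... | inj₁ v∈P = inj₁ (∈-map-face⁻ k v∈P)
... | inj₂ v∈Q = inj₂ (∈-map-face⁻ k v∈Q)

across-spans : ∀ k b → Spans X P → Spans Y Q → Spans (across k b X Y) (across k b P Q)
across-spans {X = X} {P = P} {Y = Y} {Q = Q} k b SP SQ = record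
  { unique = Unique.++⁺ (Unique.map⁺ (proj₁ ∘ face-injective k) (Spans.unique SP))
                        (Unique.map⁺ (proj₁ ∘ face-injective k) (Spans.unique SQ))
                        disjoint
  ; avoids = All.++⁺ (All.map⁺ (All.map avoidsᵇ (Spans.avoids SP)))
                     (All.map⁺ (All.map avoids¬ᵇ (Spans.avoids SQ)))
  ; covers = covers
  }
  where
  b≢¬b : b ≢ not b
  b≢¬b = Boolₚ.not-¬ refl
  disjoint : ∀ {v} → ¬ (v ∈ map (face k b) P × v ∈ map (face k (not b)) Q)
  disjoint (v∈P , v∈Q) with ∈-map⁻ _ v∈P
  ... | _ , _ , refl = b≢¬b (proj₂ (∈-map-face⁻ k v∈Q))
  avoidsᵇ : ∀ {x} → x ∉ P → face k b x ∉ across k b P Q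
  avoidsᵇ x∉P x∈ with ∈-across⁻ k x∈
  ... | inj₁ (x∈P , _)  = x∉P x∈P
  ... | inj₂ (_ , b≡¬b) = b≢¬b b≡¬b
  avoids¬ᵇ : ∀ {x} → x ∉ Q → face k (not b) x ∉ across k b P Q
  avoids¬ᵇ x∉Q x∈ with ∈-across⁻ k x∈
  ... | inj₁ (_ , ¬b≡b) = b≢¬b (sym ¬b≡b)
  ... | inj₂ (x∈Q , _)  = x∉Q x∈Q
  covers : ∀ v → v ∉ across k b X Y → v ∈ across k b P Q
  covers v v∉ with faceView k v
  ... | face-of c u with c Boolₚ.≟ b
  ...   | yes refl = ∈-++⁺ˡ (∈-map⁺ _ (Spans.covers SP u (v∉ ∘ ∈-++⁺ˡ ∘ ∈-map⁺ _)))
  ...   | no c≢b with Boolₚ.¬-not c≢b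
  ...     | refl = ∈-++⁺ʳ _ (∈-map⁺ _ (Spans.covers SQ u (v∉ ∘ ∈-++⁺ʳ _ ∘ ∈-map⁺ _)))

hamiltonianPath-across : ∀ k b → HamiltonianPath X x u P → HamiltonianPath Y u y Q →
  HamiltonianPath (across k b X Y) (face k b x) (face k (not b) y) (across k b P Q)
hamiltonianPath-across {u = u} k b (xu , SP) (uy , SQ) =
  walk-++ (walk-map (face k b) (face-adjacent k b) xu) (face-flip-adjacent k b u)
          (walk-map (face k (not b)) (face-adjacent k (not b)) uy) ,
  across-spans k b SP SQ

-- The walk p ∷ P in face b, with its first edge replaced by a detour along H through face ¬b.
detour : Fin (suc m) → Bool → List (Vertex m) → Vertex m → List (Vertex m) → List (Vertex (suc m))
detour k b H p P = face k b p ∷ map (face k (not b)) H ++ map (face k b) P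

hamiltonianPath-detour : ∀ k b → HamiltonianPath X p t (p ∷ q ∷ R) → HamiltonianPath [] p q H →
  HamiltonianPath (map (face k b) X) (face k b p) (face k b t) (detour k b H p (q ∷ R))
hamiltonianPath-detour {X = X} {p = p} {q = q} {R = R} {H = H} k b (step _ qt , SP) (pq , SH) =
  walk-∷ (face-flip-adjacent k b p)
    (walk-++ (walk-map (face k (not b)) (face-adjacent k (not b)) pq)
             (adjacent-sym {x = face k b q} (face-flip-adjacent k b q))
             (walk-map (face k b) (face-adjacent k b) qt)) ,
  subst (λ X′ → Spans X′ _) (++-identityʳ (map (face k b) X))
        (spans-resp-↭ (↭-prep _ (++-comm (map (face k b) (q ∷ R)) (map (face k (not b)) H)))
                      (across-spans k b SP SH))

-- Havel's theorem: Q_m is Hamiltonian laceable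

hamiltonianPath-Q₀ : HamiltonianPath [] [] [] ([] ∷ [])
hamiltonianPath-Q₀ = [ [] ] , record { unique = [] ∷ [] ; avoids = [] ; covers = λ { [] _ → here refl } }

parity-same : ∀ a (x y : Vertex m) → parity (a ∷ x) ≡ not (parity (a ∷ y)) → parity x ≡ not (parity y)
parity-same true  x y e = Boolₚ.not-injective e
parity-same false x y e = e

parity-across : ∀ a (x y : Vertex m) → parity (a ∷ x) ≡ not (parity (not a ∷ y)) → parity x ≡ parity y
parity-across true  x y e = Boolₚ.not-injective e
parity-across false x y e = trans e (Boolₚ.not-involutive _)

mutual
  laceable : (x y : Vertex m) → parity x ≡ not (parity y) → ∃[ P ] HamiltonianPath [] x y P
  laceable [] [] ()
  laceable (a ∷ x) (c ∷ y) e with a Boolₚ.≟ c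
  ... | no a≢c with Boolₚ.¬-not (a≢c ∘ sym)
  ...   | refl = laceable-across a x y (parity-across a x y e)
  laceable (a ∷ x) (c ∷ y) e | yes refl with laceable x y (parity-same a x y e)
  ... | _ , ([ _ ] , _) = contradiction e (Boolₚ.not-¬ refl)
  ... | _ , ham@(step {y = q} xq _ , _) with laceable x q (adjacent-parity {x = x} xq)
  ...   | H , hamH = detour zero a H x _ , hamiltonianPath-detour zero a ham hamH

  laceable-across : ∀ a (x y : Vertex m) → parity x ≡ parity y →
    ∃[ P ] HamiltonianPath [] (a ∷ x) (not a ∷ y) P
  laceable-across a [] [] _ = _ , hamiltonianPath-across zero a hamiltonianPath-Q₀ hamiltonianPath-Q₀
  laceable-across a (d ∷ x) y e =
    _ , hamiltonianPath-across zero a (proj₂ (laceable (d ∷ x) x′ (adjacent-parity {x = d ∷ x} x~x′)))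
                                      (proj₂ (laceable x′ y x′≁y))
    where
    x′ : Vertex _
    x′ = not d ∷ x
    x~x′ : Adjacent (d ∷ x) x′
    x~x′ = face-flip-adjacent zero d x
    x′≁y : parity x′ ≡ not (parity y)
    x′≁y = trans (adjacent-parity {x = x′} (adjacent-sym {x = d ∷ x} x~x′)) (cong not e)

-- Hamiltonian paths of Q_m − 𝟎 and Q_m − 𝟏

hamiltonianPath-complement : HamiltonianPath X s t P →
  HamiltonianPath (map complement X) (complement s) (complement t) (map complement P)
hamiltonianPath-complement {X = X} {P = P} (walk , SP) =
  walk-map complement (λ {x} {y} xy → trans (hamming-complement x y) xy) walk ,
  record
    { unique = Unique.map⁺ complement-injective unique
    ; avoids = All.map⁺ (All.map (λ x∉P → x∉P ∘ ∈-map-complement⁻) avoids)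
    ; covers = λ v v∉X →
        subst (_∈ map complement P) (complement-involutive v)
          (∈-map⁺ complement (covers (complement v)
            (v∉X ∘ subst (_∈ map complement X) (complement-involutive v) ∘ ∈-map⁺ complement)))
    }
  where
  open Spans SP
  ∈-map-complement⁻ : complement x ∈ map complement P → x ∈ P
  ∈-map-complement⁻ x∈ with ∈-map⁻ complement x∈
  ... | _ , y∈P , e = subst (_∈ P) (sym (complement-injective e)) y∈P

record EdgeConfiguration (s t w z : Vertex m) : Set where
  field
    ∣s∣ : weight s ≡ 1
    ∣t∣ : weight t ≡ 1
    ∣w∣ : weight w ≡ 1
    ∣z∣ : weight z ≡ 2
    s≢t : s ≢ t
    s≢w : s ≢ w
    t≢w : t ≢ w
    w~z : Adjacent w z

  ∣s∣+∣t∣+∣z∣ : sum (map weight (s ∷ t ∷ z ∷ [])) ≡ 4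
  ∣s∣+∣t∣+∣z∣ = cong₂ _+_ ∣s∣ (cong₂ _+_ ∣t∣ (cong (_+ 0) ∣z∣))

  ∣z∣≡1+∣w∣ : weight z ≡ suc (weight w)
  ∣z∣≡1+∣w∣ = trans ∣z∣ (cong suc (sym ∣w∣))

  s≢z : s ≢ z
  s≢z s≡z = contradiction (trans (sym ∣s∣) (trans (cong weight s≡z) ∣z∣)) λ ()

HamiltonianPathThroughEdge : (s t w z : Vertex m) → Set
HamiltonianPathThroughEdge {m} s t w z = ∃[ P ] (HamiltonianPath (𝟎 m ∷ []) s t P × UsesEdge w z P)

edgeConfiguration-face⁻ : ∀ k →
  EdgeConfiguration (face k false s) (face k false t) (face k false w) (face k false z) →
  EdgeConfiguration s t w z
edgeConfiguration-face⁻ {s = s} {t = t} {w = w} {z = z} k cfg = record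
  { ∣s∣ = trans (sym (weight-face k false s)) ∣s∣
  ; ∣t∣ = trans (sym (weight-face k false t)) ∣t∣
  ; ∣w∣ = trans (sym (weight-face k false w)) ∣w∣
  ; ∣z∣ = trans (sym (weight-face k false z)) ∣z∣
  ; s≢t = s≢t ∘ cong (face k false)
  ; s≢w = s≢w ∘ cong (face k false)
  ; t≢w = t≢w ∘ cong (face k false)
  ; w~z = trans (sym (hamming-face k false w z)) w~z
  }
  where open EdgeConfiguration cfg

module _ {m : ℕ} where
  open import Data.List.Membership.DecPropositional (_≟ᵥ_ {m = m}) using (_∈?_; _∉?_)
  open import Data.List.Relation.Unary.Unique.DecPropositional (_≟ᵥ_ {m = m}) using (unique?)

  -- Vertex m is Subset m from Data.Fin.Subset.
  all-vertices? : {Q : Vertex m → Set} → (∀ v → Dec (Q v)) → Dec (∀ v → Q v)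
  all-vertices? Q? =
    map′ (λ ∄¬Q v → decidable-stable (Q? v) (λ ¬Qv → ∄¬Q (v , ¬Qv))) (λ all (v , ¬Qv) → ¬Qv (all v))
         (¬? (anySubset? (¬? ∘ Q?)))

  hamiltonianPath? : ∀ X (s t : Vertex m) P → Dec (HamiltonianPath X s t P)
  hamiltonianPath? X s t P =
    walk? s t P ×-dec
    map′ (λ (P! , X∉P , covers) → record { unique = P! ; avoids = X∉P ; covers = covers })
         (λ S → Spans.unique S , Spans.avoids S , Spans.covers S)
         (unique? P ×-dec all? (_∉? P) X ×-dec all-vertices? (λ v → v ∉? X →-dec v ∈? P))

vertex : (m : ℕ) → ℕ → Vertex m
vertex zero    _ = []
vertex (suc m) c = (c % 2 ℕ.≡ᵇ 1) ∷ vertex m (c / 2)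

code : Vertex m → ℕ
code []      = 0
code (b ∷ v) = (if b then 1 else 0) + 2 * code v

-- For each configuration in Q₄ (vertices as binary numbers, coordinate i having
-- value 2^i), the parts of a Hamiltonian path of Q₄ − 𝟎 before and after the edge w z.
table : (s t w z : ℕ) → List ℕ × List ℕ
table 1 2 4 5 = 1 ∷ 3 ∷ 7 ∷ 6 ∷ [] , 13 ∷ 12 ∷ 14 ∷ 15 ∷ 11 ∷ 9 ∷ 8 ∷ 10 ∷ 2 ∷ []
table 1 2 4 6 = 1 ∷ 3 ∷ 7 ∷ 5 ∷ [] , 14 ∷ 15 ∷ 13 ∷ 12 ∷ 8 ∷ 9 ∷ 11 ∷ 10 ∷ 2 ∷ []
table 1 2 4 12 = 1 ∷ 3 ∷ 7 ∷ 6 ∷ 14 ∷ 15 ∷ 13 ∷ 5 ∷ [] , 8 ∷ 9 ∷ 11 ∷ 10 ∷ 2 ∷ []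
table 1 2 8 9 = 1 ∷ 3 ∷ 7 ∷ 6 ∷ 4 ∷ 5 ∷ 13 ∷ 12 ∷ [] , 11 ∷ 15 ∷ 14 ∷ 10 ∷ 2 ∷ []
table 1 2 8 10 = 1 ∷ 3 ∷ 7 ∷ 6 ∷ 4 ∷ 5 ∷ 13 ∷ 12 ∷ 14 ∷ 15 ∷ 11 ∷ 9 ∷ [] , 2 ∷ []
table 1 2 8 12 = 1 ∷ 3 ∷ 7 ∷ 6 ∷ 4 ∷ 5 ∷ 13 ∷ 15 ∷ 11 ∷ 9 ∷ [] , 14 ∷ 10 ∷ 2 ∷ []
table 1 4 2 3 = 1 ∷ 5 ∷ 7 ∷ 6 ∷ [] , 11 ∷ 10 ∷ 8 ∷ 9 ∷ 13 ∷ 15 ∷ 14 ∷ 12 ∷ 4 ∷ []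
table 1 4 2 6 = 1 ∷ 3 ∷ [] , 7 ∷ 5 ∷ 13 ∷ 15 ∷ 14 ∷ 10 ∷ 11 ∷ 9 ∷ 8 ∷ 12 ∷ 4 ∷ []
table 1 4 2 10 = 1 ∷ 3 ∷ [] , 11 ∷ 9 ∷ 8 ∷ 12 ∷ 13 ∷ 15 ∷ 14 ∷ 6 ∷ 7 ∷ 5 ∷ 4 ∷ []
table 1 4 8 9 = 1 ∷ 3 ∷ 2 ∷ 6 ∷ 7 ∷ 15 ∷ 11 ∷ 10 ∷ 14 ∷ 12 ∷ [] , 13 ∷ 5 ∷ 4 ∷ []
table 1 4 8 10 = 1 ∷ 3 ∷ 2 ∷ 6 ∷ 7 ∷ 5 ∷ 13 ∷ 15 ∷ 11 ∷ 9 ∷ [] , 14 ∷ 12 ∷ 4 ∷ []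
table 1 4 8 12 = 1 ∷ 3 ∷ 2 ∷ 6 ∷ 7 ∷ 5 ∷ 13 ∷ 15 ∷ 14 ∷ 10 ∷ 11 ∷ 9 ∷ [] , 4 ∷ []
table 1 8 2 3 = 1 ∷ 5 ∷ 4 ∷ 6 ∷ 7 ∷ 15 ∷ 14 ∷ 10 ∷ [] , 11 ∷ 9 ∷ 13 ∷ 12 ∷ 8 ∷ []
table 1 8 2 6 = 1 ∷ 3 ∷ [] , 7 ∷ 5 ∷ 4 ∷ 12 ∷ 13 ∷ 15 ∷ 14 ∷ 10 ∷ 11 ∷ 9 ∷ 8 ∷ []
table 1 8 2 10 = 1 ∷ 3 ∷ [] , 11 ∷ 9 ∷ 13 ∷ 15 ∷ 14 ∷ 6 ∷ 7 ∷ 5 ∷ 4 ∷ 12 ∷ 8 ∷ []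
table 1 8 4 5 = 1 ∷ 3 ∷ 2 ∷ 6 ∷ 7 ∷ 15 ∷ 14 ∷ 12 ∷ [] , 13 ∷ 9 ∷ 11 ∷ 10 ∷ 8 ∷ []
table 1 8 4 6 = 1 ∷ 3 ∷ 2 ∷ 10 ∷ 11 ∷ 9 ∷ 13 ∷ 15 ∷ 7 ∷ 5 ∷ [] , 14 ∷ 12 ∷ 8 ∷ []
table 1 8 4 12 = 1 ∷ 3 ∷ 2 ∷ 6 ∷ 7 ∷ 5 ∷ [] , 13 ∷ 15 ∷ 14 ∷ 10 ∷ 11 ∷ 9 ∷ 8 ∷ []
table 2 1 4 5 = 2 ∷ 3 ∷ 7 ∷ 6 ∷ [] , 13 ∷ 12 ∷ 14 ∷ 15 ∷ 11 ∷ 10 ∷ 8 ∷ 9 ∷ 1 ∷ []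
table 2 1 4 6 = 2 ∷ 3 ∷ 7 ∷ 5 ∷ [] , 14 ∷ 15 ∷ 13 ∷ 12 ∷ 8 ∷ 10 ∷ 11 ∷ 9 ∷ 1 ∷ []
table 2 1 4 12 = 2 ∷ 3 ∷ 7 ∷ 6 ∷ [] , 14 ∷ 15 ∷ 11 ∷ 10 ∷ 8 ∷ 9 ∷ 13 ∷ 5 ∷ 1 ∷ []
table 2 1 8 9 = 2 ∷ 3 ∷ 7 ∷ 6 ∷ 4 ∷ 5 ∷ 13 ∷ 12 ∷ 14 ∷ 15 ∷ 11 ∷ 10 ∷ [] , 1 ∷ []
table 2 1 8 10 = 2 ∷ 3 ∷ 7 ∷ 6 ∷ 4 ∷ 5 ∷ 13 ∷ 12 ∷ [] , 14 ∷ 15 ∷ 11 ∷ 9 ∷ 1 ∷ []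
table 2 1 8 12 = 2 ∷ 3 ∷ 7 ∷ 6 ∷ 14 ∷ 15 ∷ 13 ∷ 9 ∷ 11 ∷ 10 ∷ [] , 4 ∷ 5 ∷ 1 ∷ []
table 2 4 1 3 = 2 ∷ 6 ∷ 7 ∷ 5 ∷ [] , 11 ∷ 10 ∷ 8 ∷ 9 ∷ 13 ∷ 15 ∷ 14 ∷ 12 ∷ 4 ∷ []
table 2 4 1 5 = 2 ∷ 3 ∷ [] , 7 ∷ 6 ∷ 14 ∷ 15 ∷ 13 ∷ 9 ∷ 11 ∷ 10 ∷ 8 ∷ 12 ∷ 4 ∷ []
table 2 4 1 9 = 2 ∷ 3 ∷ [] , 8 ∷ 10 ∷ 11 ∷ 15 ∷ 14 ∷ 12 ∷ 13 ∷ 5 ∷ 7 ∷ 6 ∷ 4 ∷ []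
table 2 4 8 9 = 2 ∷ 3 ∷ 1 ∷ 5 ∷ 7 ∷ 6 ∷ 14 ∷ 15 ∷ 11 ∷ 10 ∷ [] , 13 ∷ 12 ∷ 4 ∷ []
table 2 4 8 10 = 2 ∷ 3 ∷ 1 ∷ 5 ∷ 7 ∷ 15 ∷ 11 ∷ 9 ∷ 13 ∷ 12 ∷ [] , 14 ∷ 6 ∷ 4 ∷ []
table 2 4 8 12 = 2 ∷ 3 ∷ 1 ∷ 5 ∷ 7 ∷ 6 ∷ 14 ∷ 15 ∷ 13 ∷ 9 ∷ 11 ∷ 10 ∷ [] , 4 ∷ []
table 2 8 1 3 = 2 ∷ 6 ∷ 7 ∷ 5 ∷ 4 ∷ 12 ∷ 13 ∷ 9 ∷ [] , 11 ∷ 15 ∷ 14 ∷ 10 ∷ 8 ∷ []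
table 2 8 1 5 = 2 ∷ 3 ∷ [] , 4 ∷ 6 ∷ 7 ∷ 15 ∷ 14 ∷ 12 ∷ 13 ∷ 9 ∷ 11 ∷ 10 ∷ 8 ∷ []
table 2 8 1 9 = 2 ∷ 3 ∷ [] , 11 ∷ 10 ∷ 14 ∷ 15 ∷ 13 ∷ 5 ∷ 7 ∷ 6 ∷ 4 ∷ 12 ∷ 8 ∷ []
table 2 8 4 5 = 2 ∷ 3 ∷ 1 ∷ 9 ∷ 11 ∷ 10 ∷ 14 ∷ 15 ∷ 7 ∷ 6 ∷ [] , 13 ∷ 12 ∷ 8 ∷ []
table 2 8 4 6 = 2 ∷ 3 ∷ 1 ∷ 5 ∷ [] , 7 ∷ 15 ∷ 14 ∷ 12 ∷ 13 ∷ 9 ∷ 11 ∷ 10 ∷ 8 ∷ []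
table 2 8 4 12 = 2 ∷ 3 ∷ 1 ∷ 5 ∷ [] , 13 ∷ 15 ∷ 7 ∷ 6 ∷ 14 ∷ 10 ∷ 11 ∷ 9 ∷ 8 ∷ []
table 4 1 2 3 = 4 ∷ 5 ∷ 7 ∷ 6 ∷ [] , 11 ∷ 10 ∷ 8 ∷ 12 ∷ 14 ∷ 15 ∷ 13 ∷ 9 ∷ 1 ∷ []
table 4 1 2 6 = 4 ∷ 5 ∷ 7 ∷ 3 ∷ [] , 14 ∷ 15 ∷ 13 ∷ 12 ∷ 8 ∷ 10 ∷ 11 ∷ 9 ∷ 1 ∷ []
table 4 1 2 10 = 4 ∷ 5 ∷ 7 ∷ 6 ∷ [] , 8 ∷ 9 ∷ 13 ∷ 12 ∷ 14 ∷ 15 ∷ 11 ∷ 3 ∷ 1 ∷ []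
table 4 1 8 9 = 4 ∷ 5 ∷ 7 ∷ 6 ∷ 2 ∷ 3 ∷ 11 ∷ 10 ∷ 14 ∷ 15 ∷ 13 ∷ 12 ∷ [] , 1 ∷ []
table 4 1 8 10 = 4 ∷ 5 ∷ 7 ∷ 6 ∷ 14 ∷ 15 ∷ 13 ∷ 12 ∷ [] , 2 ∷ 3 ∷ 11 ∷ 9 ∷ 1 ∷ []
table 4 1 8 12 = 4 ∷ 5 ∷ 7 ∷ 6 ∷ 2 ∷ 3 ∷ 11 ∷ 10 ∷ [] , 14 ∷ 15 ∷ 13 ∷ 9 ∷ 1 ∷ []
table 4 2 1 3 = 4 ∷ 5 ∷ 7 ∷ 6 ∷ 14 ∷ 15 ∷ 13 ∷ 12 ∷ 8 ∷ 9 ∷ [] , 11 ∷ 10 ∷ 2 ∷ []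
table 4 2 1 5 = 4 ∷ 6 ∷ 7 ∷ 3 ∷ [] , 13 ∷ 12 ∷ 14 ∷ 15 ∷ 11 ∷ 9 ∷ 8 ∷ 10 ∷ 2 ∷ []
table 4 2 1 9 = 4 ∷ 5 ∷ 7 ∷ 6 ∷ 14 ∷ 15 ∷ 11 ∷ 3 ∷ [] , 13 ∷ 12 ∷ 8 ∷ 10 ∷ 2 ∷ []
table 4 2 8 9 = 4 ∷ 5 ∷ 7 ∷ 6 ∷ 14 ∷ 15 ∷ 13 ∷ 12 ∷ [] , 1 ∷ 3 ∷ 11 ∷ 10 ∷ 2 ∷ []
table 4 2 8 10 = 4 ∷ 5 ∷ 7 ∷ 6 ∷ 14 ∷ 15 ∷ 13 ∷ 12 ∷ [] , 11 ∷ 9 ∷ 1 ∷ 3 ∷ 2 ∷ []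
table 4 2 8 12 = 4 ∷ 5 ∷ 7 ∷ 6 ∷ 14 ∷ 15 ∷ 11 ∷ 10 ∷ [] , 13 ∷ 9 ∷ 1 ∷ 3 ∷ 2 ∷ []
table 4 8 1 3 = 4 ∷ 5 ∷ 7 ∷ 6 ∷ 14 ∷ 12 ∷ 13 ∷ 15 ∷ 11 ∷ 9 ∷ [] , 2 ∷ 10 ∷ 8 ∷ []
table 4 8 1 5 = 4 ∷ 6 ∷ 7 ∷ 3 ∷ 2 ∷ 10 ∷ 11 ∷ 9 ∷ [] , 13 ∷ 15 ∷ 14 ∷ 12 ∷ 8 ∷ []
table 4 8 1 9 = 4 ∷ 5 ∷ 7 ∷ 6 ∷ 2 ∷ 3 ∷ [] , 11 ∷ 10 ∷ 14 ∷ 15 ∷ 13 ∷ 12 ∷ 8 ∷ []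
table 4 8 2 3 = 4 ∷ 5 ∷ 7 ∷ 6 ∷ [] , 1 ∷ 9 ∷ 11 ∷ 10 ∷ 14 ∷ 15 ∷ 13 ∷ 12 ∷ 8 ∷ []
table 4 8 2 6 = 4 ∷ 5 ∷ 7 ∷ 3 ∷ 1 ∷ 9 ∷ 11 ∷ 10 ∷ [] , 14 ∷ 15 ∷ 13 ∷ 12 ∷ 8 ∷ []
table 4 8 2 10 = 4 ∷ 5 ∷ 7 ∷ 6 ∷ [] , 11 ∷ 3 ∷ 1 ∷ 9 ∷ 13 ∷ 15 ∷ 14 ∷ 12 ∷ 8 ∷ []
table 8 1 2 3 = 8 ∷ 9 ∷ 11 ∷ 10 ∷ 14 ∷ 15 ∷ 13 ∷ 12 ∷ 4 ∷ 5 ∷ 7 ∷ 6 ∷ [] , 1 ∷ []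
table 8 1 2 6 = 8 ∷ 9 ∷ 11 ∷ 10 ∷ 14 ∷ 15 ∷ 7 ∷ 3 ∷ [] , 4 ∷ 12 ∷ 13 ∷ 5 ∷ 1 ∷ []
table 8 1 2 10 = 8 ∷ 9 ∷ 11 ∷ 15 ∷ 7 ∷ 3 ∷ [] , 14 ∷ 6 ∷ 4 ∷ 12 ∷ 13 ∷ 5 ∷ 1 ∷ []
table 8 1 4 5 = 8 ∷ 9 ∷ 11 ∷ 10 ∷ 14 ∷ 15 ∷ 13 ∷ 12 ∷ [] , 7 ∷ 6 ∷ 2 ∷ 3 ∷ 1 ∷ []
table 8 1 4 6 = 8 ∷ 9 ∷ 11 ∷ 10 ∷ 14 ∷ 15 ∷ 13 ∷ 12 ∷ [] , 2 ∷ 3 ∷ 7 ∷ 5 ∷ 1 ∷ []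
table 8 1 4 12 = 8 ∷ 9 ∷ 11 ∷ 10 ∷ 14 ∷ 15 ∷ 7 ∷ 3 ∷ 2 ∷ 6 ∷ [] , 13 ∷ 5 ∷ 1 ∷ []
table 8 2 1 3 = 8 ∷ 9 ∷ 11 ∷ 10 ∷ 14 ∷ 15 ∷ 13 ∷ 12 ∷ 4 ∷ 5 ∷ [] , 7 ∷ 6 ∷ 2 ∷ []
table 8 2 1 5 = 8 ∷ 9 ∷ 11 ∷ 10 ∷ 14 ∷ 15 ∷ 7 ∷ 3 ∷ [] , 13 ∷ 12 ∷ 4 ∷ 6 ∷ 2 ∷ []
table 8 2 1 9 = 8 ∷ 10 ∷ 11 ∷ 15 ∷ 7 ∷ 3 ∷ [] , 13 ∷ 5 ∷ 4 ∷ 12 ∷ 14 ∷ 6 ∷ 2 ∷ []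
table 8 2 4 5 = 8 ∷ 9 ∷ 11 ∷ 10 ∷ 14 ∷ 15 ∷ 13 ∷ 12 ∷ [] , 1 ∷ 3 ∷ 7 ∷ 6 ∷ 2 ∷ []
table 8 2 4 6 = 8 ∷ 9 ∷ 11 ∷ 10 ∷ 14 ∷ 15 ∷ 13 ∷ 12 ∷ [] , 7 ∷ 5 ∷ 1 ∷ 3 ∷ 2 ∷ []
table 8 2 4 12 = 8 ∷ 9 ∷ 11 ∷ 10 ∷ 14 ∷ 15 ∷ 7 ∷ 6 ∷ [] , 13 ∷ 5 ∷ 1 ∷ 3 ∷ 2 ∷ []
table 8 4 1 3 = 8 ∷ 9 ∷ 11 ∷ 10 ∷ 14 ∷ 12 ∷ 13 ∷ 15 ∷ 7 ∷ 5 ∷ [] , 2 ∷ 6 ∷ 4 ∷ []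
table 8 4 1 5 = 8 ∷ 9 ∷ 11 ∷ 10 ∷ 14 ∷ 15 ∷ 7 ∷ 6 ∷ 2 ∷ 3 ∷ [] , 13 ∷ 12 ∷ 4 ∷ []
table 8 4 1 9 = 8 ∷ 10 ∷ 11 ∷ 15 ∷ 14 ∷ 6 ∷ 2 ∷ 3 ∷ 7 ∷ 5 ∷ [] , 13 ∷ 12 ∷ 4 ∷ []
table 8 4 2 3 = 8 ∷ 9 ∷ 11 ∷ 10 ∷ 14 ∷ 15 ∷ 7 ∷ 6 ∷ [] , 1 ∷ 5 ∷ 13 ∷ 12 ∷ 4 ∷ []
table 8 4 2 6 = 8 ∷ 9 ∷ 11 ∷ 10 ∷ 14 ∷ 12 ∷ 13 ∷ 15 ∷ 7 ∷ 5 ∷ 1 ∷ 3 ∷ [] , 4 ∷ []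
table 8 4 2 10 = 8 ∷ 9 ∷ 11 ∷ 15 ∷ 13 ∷ 5 ∷ 1 ∷ 3 ∷ 7 ∷ 6 ∷ [] , 14 ∷ 12 ∷ 4 ∷ []
table _ _ _ _ = [] , []

certificate : (s t w z : Vertex 4) → List (Vertex 4) × List (Vertex 4)
certificate s t w z = Product.map (map (vertex 4)) (map (vertex 4)) (table (code s) (code t) (code w) (code z))

certificate-valid : ∀ s → weight s ≡ 1 → ∀ t → weight t ≡ 1 → s ≢ t → ∀ w → weight w ≡ 1 → s ≢ w → t ≢ w →
  ∀ z → weight z ≡ 2 → Adjacent w z →
  HamiltonianPath (𝟎 4 ∷ []) s t (proj₁ (certificate s t w z) ++ w ∷ z ∷ proj₂ (certificate s t w z))
certificate-valid = toWitness {a? = decision} tt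
  where
  decision : Dec (∀ s → weight s ≡ 1 → ∀ t → weight t ≡ 1 → s ≢ t → ∀ w → weight w ≡ 1 → s ≢ w → t ≢ w →
    ∀ z → weight z ≡ 2 → Adjacent w z →
    HamiltonianPath (𝟎 4 ∷ []) s t (proj₁ (certificate s t w z) ++ w ∷ z ∷ proj₂ (certificate s t w z)))
  decision = all-vertices? λ s → weight s ℕ.≟ 1 →-dec
             all-vertices? λ t → weight t ℕ.≟ 1 →-dec ¬? (s ≟ᵥ t) →-dec
             all-vertices? λ w → weight w ℕ.≟ 1 →-dec ¬? (s ≟ᵥ w) →-dec ¬? (t ≟ᵥ w) →-dec
             all-vertices? λ z → weight z ℕ.≟ 2 →-dec adjacent? w z →-dec
             hamiltonianPath? (𝟎 4 ∷ []) s t _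

lift-avoiding-𝟎-through-edge : ∀ k → EdgeConfiguration s t w z → HamiltonianPathThroughEdge s t w z →
  HamiltonianPathThroughEdge (face k false s) (face k false t) (face k false w) (face k false z)
lift-avoiding-𝟎-through-edge k cfg (_ , ([ _ ] , _) , _) = contradiction refl (EdgeConfiguration.s≢t cfg)
lift-avoiding-𝟎-through-edge {s = s} k cfg (_ , ham@(step {y = q} sq _ , _) , wz)
  with laceable s q (adjacent-parity {x = s} sq)
... | H , hamH =
  _ , hamiltonianPath-≡ (cong (_∷ []) (face-𝟎 k)) refl refl (hamiltonianPath-detour k false ham hamH) ,
  usesEdge-++ʳ (face k false s ∷ map (face k true) H) (usesEdge-map (face k false) (usesEdge-∷⁻ wz s≢w s≢z))
  where open EdgeConfiguration cfg

avoiding-𝟎-through-edge-Q₄ : {s t w z : Vertex 4} → EdgeConfiguration s t w z → HamiltonianPathThroughEdge s t w z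
avoiding-𝟎-through-edge-Q₄ {s = s} {t = t} {w = w} {z = z} cfg =
  _ , certificate-valid s ∣s∣ t ∣t∣ s≢t w ∣w∣ s≢w t≢w z ∣z∣ w~z ,
  proj₁ (certificate s t w z) , proj₂ (certificate s t w z) , inj₁ refl
  where open EdgeConfiguration cfg

avoiding-𝟎-through-edge : {s t w z : Vertex m} → 4 ≤ m → EdgeConfiguration s t w z → HamiltonianPathThroughEdge s t w z
avoiding-𝟎-through-edge 4≤m = go (≤⇒≤′ 4≤m)
  where
  go : ∀ {m} {s t w z : Vertex m} → 4 ≤′ m → EdgeConfiguration s t w z → HamiltonianPathThroughEdge s t w z
  go ≤′-refl                       cfg = avoiding-𝟎-through-edge-Q₄ cfg
  go {suc m} {s} {t} {w} {z} (≤′-step 4≤m) cfg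
    with free-coordinate (s ∷ t ∷ z ∷ [])
           (subst (_< suc m) (sym (EdgeConfiguration.∣s∣+∣t∣+∣z∣ cfg)) (s≤s (≤′⇒≤ 4≤m)))
  ... | k , sₖ ∷ tₖ ∷ zₖ ∷ []
    with lookup⇒face s k sₖ | lookup⇒face t k tₖ | lookup⇒face z k zₖ
       | lookup⇒face w k (lookup-false-below w z k (EdgeConfiguration.w~z cfg)
                                               (EdgeConfiguration.∣z∣≡1+∣w∣ cfg) zₖ)
  ... | s′ , refl | t′ , refl | z′ , refl | w′ , refl =
    lift-avoiding-𝟎-through-edge k cfg′ (go 4≤m cfg′)
    where
    cfg′ : EdgeConfiguration s′ t′ w′ z′
    cfg′ = edgeConfiguration-face⁻ k cfg

avoiding-𝟎 : 4 ≤ m → weight s ≡ 1 → weight t ≡ 1 → s ≢ t → ∃[ P ] HamiltonianPath (𝟎 m ∷ []) s t P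
avoiding-𝟎 {zero}        ()
avoiding-𝟎 {suc zero}    (s≤s ())
avoiding-𝟎 {suc (suc m)} {s} {t} 4≤m ∣s∣ ∣t∣ s≢t
  with free-coordinate (s ∷ t ∷ [])
         (subst (_< suc (suc m)) (sym (cong₂ _+_ ∣s∣ (cong (_+ 0) ∣t∣))) (≤-trans (n≤1+n 3) 4≤m))
... | k , sₖ ∷ tₖ ∷ []
  with lookup⇒face s k sₖ | lookup⇒face t k tₖ
... | s′ , refl | t′ , refl = _ , proj₁ (proj₂ (avoiding-𝟎-through-edge 4≤m cfg))
  where
  -- a dummy edge in the face x_k = 1
  w₀ z₀ : Vertex (suc (suc m))
  w₀ = face k true (𝟎 (suc m))
  z₀ = face k true (true ∷ 𝟎 m)
  cfg : EdgeConfiguration (face k false s′) (face k false t′) w₀ z₀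
  cfg = record
    { ∣s∣ = ∣s∣
    ; ∣t∣ = ∣t∣
    ; ∣w∣ = trans (weight-face k true (𝟎 (suc m))) (cong suc (weight-𝟎 (suc m)))
    ; ∣z∣ = trans (weight-face k true (true ∷ 𝟎 m)) (cong (λ n → suc (suc n)) (weight-𝟎 m))
    ; s≢t = s≢t
    ; s≢w = faces-disjoint k
    ; t≢w = faces-disjoint k
    ; w~z = trans (hamming-face k true (𝟎 (suc m)) (true ∷ 𝟎 m)) (cong suc (hamming-refl (𝟎 m)))
    }

avoiding-𝟏 : 4 ≤ m → weight (complement s) ≡ 1 → weight (complement t) ≡ 1 → s ≢ t →
  ∃[ P ] HamiltonianPath (𝟏 m ∷ []) s t P
avoiding-𝟏 {m} {s} {t} 4≤m ∣s̄∣ ∣t̄∣ s≢t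
  with hamiltonianPath-complement (proj₂ (avoiding-𝟎 4≤m ∣s̄∣ ∣t̄∣ (s≢t ∘ complement-injective)))
... | ham = _ , hamiltonianPath-≡ (cong (_∷ []) (map-replicate not false m))
                                (complement-involutive s) (complement-involutive t) ham

TwoPathCover : (n : ℕ) (u₁ v₁ w₁ z₁ u₂ v₂ : Vertex n) → Set
TwoPathCover n u₁ v₁ w₁ z₁ u₂ v₂ = ∃[ P ] ∃[ Q ]
  (IsPath u₁ v₁ P × UsesEdge w₁ z₁ P × IsPath u₂ v₂ Q
  × 𝟎 n ∉ P × 𝟏 n ∉ P × 𝟎 n ∉ Q × 𝟏 n ∉ Q
  × ((x : Vertex n) → x ∈ P → x ∉ Q)
  × ((x : Vertex n) → x ≢ 𝟎 n → x ≢ 𝟏 n → x ∈ P ⊎ x ∈ Q))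

two-path-cover : ∀ k → HamiltonianPath (𝟎 m ∷ []) s t P → UsesEdge w z P → HamiltonianPath (𝟏 m ∷ []) u v Q →
  TwoPathCover (suc m) (face k false s) (face k false t) (face k false w) (face k false z)
                       (face k true u) (face k true v)
two-path-cover {m = m} {P = P} {Q = Q} k (st , SP) wz (uv , SQ) =
  map (face k false) P , map (face k true) Q ,
  walk⇒isPath (walk-map (face k false) (face-adjacent k false) st)
              (Unique.map⁺ (proj₁ ∘ face-injective k) (Spans.unique SP)) ,
  usesEdge-map (face k false) wz ,
  walk⇒isPath (walk-map (face k true) (face-adjacent k true) uv)
              (Unique.map⁺ (proj₁ ∘ face-injective k) (Spans.unique SQ)) ,
  𝟎∉ ∘ ∈-++⁺ˡ , 𝟏∉ ∘ ∈-++⁺ˡ , 𝟎∉ ∘ ∈-++⁺ʳ _ , 𝟏∉ ∘ ∈-++⁺ʳ _ ,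
  disjoint , cover
  where
  S : Spans (face k false (𝟎 m) ∷ face k true (𝟏 m) ∷ []) (across k false P Q)
  S = across-spans k false SP SQ
  𝟎∉ : 𝟎 (suc m) ∉ across k false P Q
  𝟎∉ = subst (_∉ across k false P Q) (face-𝟎 k) (All.head (Spans.avoids S))
  𝟏∉ : 𝟏 (suc m) ∉ across k false P Q
  𝟏∉ = subst (_∉ across k false P Q) (face-𝟏 k) (All.head (All.tail (Spans.avoids S)))
  disjoint : (x : Vertex (suc m)) → x ∈ map (face k false) P → x ∉ map (face k true) Q
  disjoint x x∈P x∈Q with ∈-map⁻ _ x∈P
  ... | _ , _ , refl with proj₂ (∈-map-face⁻ k x∈Q)
  ...   | ()
  cover : (x : Vertex (suc m)) → x ≢ 𝟎 (suc m) → x ≢ 𝟏 (suc m) → x ∈ map (face k false) P ⊎ x ∈ map (face k true) Q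
  cover x x≢𝟎 x≢𝟏 = ∈-++⁻ (map (face k false) P) (Spans.covers S x λ
    { (here x≡𝟎)         → x≢𝟎 (trans x≡𝟎 (face-𝟎 k))
    ; (there (here x≡𝟏)) → x≢𝟏 (trans x≡𝟏 (face-𝟏 k))
    })

lemma4p7 : (n : ℕ) → 7 ≤ n →
    (u₁ v₁ w₁ u₂ v₂ z₁ : Vertex n) →
    InC n 1 u₁ → InC n 1 v₁ → InC n 1 w₁ →
    u₁ ≢ v₁ → u₁ ≢ w₁ → v₁ ≢ w₁ →
    InC n (n ∸ 1) u₂ → InC n (n ∸ 1) v₂ → u₂ ≢ v₂ →
    InC n 2 z₁ → Adjacent w₁ z₁ →
    ∃[ P ] ∃[ Q ]
      (IsPath u₁ v₁ P × UsesEdge w₁ z₁ P × IsPath u₂ v₂ Q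
      × 𝟎 n ∉ P × 𝟏 n ∉ P × 𝟎 n ∉ Q × 𝟏 n ∉ Q
      × ((x : Vertex n) → x ∈ P → x ∉ Q)
      × ((x : Vertex n) → x ≢ 𝟎 n → x ≢ 𝟏 n → x ∈ P ⊎ x ∈ Q))
lemma4p7 zero ()
lemma4p7 (suc m) 7≤n u₁ v₁ w₁ u₂ v₂ z₁ (_ , ∣u₁∣) (_ , ∣v₁∣) (_ , ∣w₁∣) u₁≢v₁ u₁≢w₁ v₁≢w₁
         (_ , ∣u₂∣) (_ , ∣v₂∣) u₂≢v₂ (_ , ∣z₁∣) w₁~z₁
  with free-coordinate (u₁ ∷ v₁ ∷ z₁ ∷ complement u₂ ∷ complement v₂ ∷ []) (subst (_< suc m) (sym ∑weights) 7≤n)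
  where
  ∑weights : sum (map weight (u₁ ∷ v₁ ∷ z₁ ∷ complement u₂ ∷ complement v₂ ∷ [])) ≡ 6
  ∑weights rewrite ∣u₁∣ | ∣v₁∣ | ∣z₁∣ | weight-complement≡1 u₂ ∣u₂∣ | weight-complement≡1 v₂ ∣v₂∣ = refl
... | k , u₁ₖ ∷ v₁ₖ ∷ z₁ₖ ∷ ū₂ₖ ∷ v̄₂ₖ ∷ []
  with lookup⇒face u₁ k u₁ₖ | lookup⇒face v₁ k v₁ₖ | lookup⇒face z₁ k z₁ₖ
     | lookup⇒face w₁ k (lookup-false-below w₁ z₁ k w₁~z₁ (trans ∣z₁∣ (cong suc (sym ∣w₁∣))) z₁ₖ)
     | lookup⇒face u₂ k (lookup-complement u₂ k ū₂ₖ) | lookup⇒face v₂ k (lookup-complement v₂ k v̄₂ₖ)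
... | u₁′ , refl | v₁′ , refl | z₁′ , refl | w₁′ , refl | u₂′ , refl | v₂′ , refl =
  two-path-cover k (proj₁ (proj₂ path₁)) (proj₂ (proj₂ path₁)) (proj₂ path₂)
  where
  4≤m : 4 ≤ m
  4≤m = ≤-trans (m≤m+n 4 2) (s≤s⁻¹ 7≤n)
  path₁ : HamiltonianPathThroughEdge u₁′ v₁′ w₁′ z₁′
  path₁ = avoiding-𝟎-through-edge 4≤m (edgeConfiguration-face⁻ k (record
    { ∣s∣ = ∣u₁∣ ; ∣t∣ = ∣v₁∣ ; ∣w∣ = ∣w₁∣ ; ∣z∣ = ∣z₁∣ ; s≢t = u₁≢v₁ ; s≢w = u₁≢w₁ ; t≢w = v₁≢w₁ ; w~z = w₁~z₁ }))
  co-weight : ∀ {u} → weight (face k true u) ≡ m → weight (complement u) ≡ 1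
  co-weight {u} ∣u∣ =
    trans (sym (trans (cong weight (complement-face k true u)) (weight-face k false (complement u))))
          (weight-complement≡1 (face k true u) ∣u∣)
  path₂ : ∃[ Q ] HamiltonianPath (𝟏 m ∷ []) u₂′ v₂′ Q
  path₂ = avoiding-𝟏 4≤m (co-weight ∣u₂∣) (co-weight ∣v₂∣) (u₂≢v₂ ∘ cong (face k true))
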